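{- Let $t$ be a non-negative integer and $\ell$ a positive integer, let $H$ be a $t$-tree, let $P$ be a path, let $K_\ell$ be a complete graph on $\ell$ vertices, and let $G$ be a subgraph of the strong product $H\boxtimes P\boxtimes K_\ell$. Then $G$ has an odd colouring using at most $8\ell t+5\ell-1$ colours.
   Context: All graphs are finite and simple. A $t$-tree is a graph that is either a clique on $t+1$ vertices, or a graph $H$ containing a vertex $v$ of degree $t$ whose neighbours form a clique and such that $H-\{v\}$ is a $t$-tree. For graphs $A$ and $B$, the strong product $A\boxtimes B$ has vertex set $V(A)\times V(B)$, and $(x_1,y_1)(x_2,y_2)$ is an edge iff (i) $x_1x_2\in E(A)$ and $y_1=y_2$, or (ii) $x_1=x_2$ and $y_1y_2\in E(B)$, or (iii) $x_1x_2\in E(A)$ and $y_1y_2\in E(B)$; the triple product is $(H\boxtimes P)\boxtimes K_\ell$. A vertex colouring $\varphi:V(G)\to\mathbb{N}$ (not necessarily proper) is odd if for every vertex $v$ with $|N_G(v)|>0$ there is a colour $\alpha$ such that $|\{w\in N_G(v):\varphi(w)=\alpha\}|$ is odd. A colouring uses $c$ colours if $|\{\varphi(v):v\in V(G)\}|=c$. -}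

module Defs where

open import Data.Nat using (ℕ; zero; suc; _≡ᵇ_; _%_)
open import Data.Nat.Properties using () renaming (_≟_ to _≟ℕ_)
open import Data.Bool using (Bool; true; false; _∧_)
open import Data.Fin using (Fin; toℕ; punchIn)
open import Data.List using (List; length; map; filterᵇ; deduplicate; allFin)
open import Data.Product using (_×_; _,_; Σ; ∃)
open import Data.Sum using (_⊎_)
open import Relation.Binary.PropositionalEquality using (_≡_; _≢_)
open import Relation.Nullary using (¬_)

record Graph : Set where
  field
    n      : ℕ
    adj    : Fin n → Fin n → Bool
    sym    : ∀ i j → adj i j ≡ adj j i
    irrefl : ∀ i → adj i i ≡ false
open Graph public

count : ∀ {n} → (Fin n → Bool) → ℕ
count {n} p = length (filterᵇ p (allFin n))

degree : ∀ {n} → (Fin n → Fin n → Bool) → Fin n → ℕ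
degree A v = count (A v)

data IsTTree (t : ℕ) : (n : ℕ) → (Fin n → Fin n → Bool) → Set where
  clique : ∀ {A} → (∀ i j → i ≢ j → A i j ≡ true) → IsTTree t (suc t) A
  step   : ∀ {n A} (v : Fin (suc n)) →
           degree A v ≡ t →
           (∀ i j → A v i ≡ true → A v j ≡ true → i ≢ j → A i j ≡ true) →
           IsTTree t n (λ i j → A (punchIn v i) (punchIn v j)) →
           IsTTree t (suc n) A

TTree : ℕ → Graph → Set
TTree t H = IsTTree t (n H) (adj H)

strongAdj : {A B : Set} → (A → A → Set) → (B → B → Set) → (A × B) → (A × B) → Set
strongAdj RA RB (a₁ , b₁) (a₂ , b₂) =
  (RA a₁ a₂ × b₁ ≡ b₂) ⊎ ((a₁ ≡ a₂ × RB b₁ b₂) ⊎ (RA a₁ a₂ × RB b₁ b₂))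

pathAdj : ∀ {m} → Fin m → Fin m → Set
pathAdj i j = (toℕ j ≡ suc (toℕ i)) ⊎ (toℕ i ≡ suc (toℕ j))

completeAdj : ∀ {ℓ} → Fin ℓ → Fin ℓ → Set
completeAdj i j = i ≢ j

tripleAdj : (H : Graph) (m ℓ : ℕ) →
            ((Fin (n H) × Fin m) × Fin ℓ) → ((Fin (n H) × Fin m) × Fin ℓ) → Set
tripleAdj H m ℓ =
  strongAdj (strongAdj (λ x y → adj H x y ≡ true) (pathAdj {m})) (completeAdj {ℓ})

-- G is a subgraph of (H ⊠ P_m) ⊠ K_ℓ (up to isomorphism): an injective vertex map
-- sending edges of G to edges of the product.
IsSubgraphOfTriple : Graph → Graph → ℕ → ℕ → Set
IsSubgraphOfTriple G H m ℓ =
  Σ (Fin (n G) → (Fin (n H) × Fin m) × Fin ℓ) λ f →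
    (∀ i j → f i ≡ f j → i ≡ j) ×
    (∀ i j → adj G i j ≡ true → tripleAdj H m ℓ (f i) (f j))

-- odd colouring (not necessarily proper): every non-isolated vertex has a colour
-- appearing an odd number of times in its neighbourhood
IsOddColouring : (G : Graph) → (Fin (n G) → ℕ) → Set
IsOddColouring G φ =
  ∀ v → ¬ (count (adj G v) ≡ 0) →
    ∃ λ α → count (λ w → adj G v w ∧ (φ w ≡ᵇ α)) % 2 ≡ 1

coloursUsed : (G : Graph) → (Fin (n G) → ℕ) → ℕ
coloursUsed G φ = length (deduplicate _≟ℕ_ (map φ (allFin (n G))))

{-# OPTIONS --safe #-}
module Submission where

-- Rank the vertices of G lexicographically by (position of the H-coordinate in a
-- t-tree elimination order, path coordinate, clique coordinate) and colour greedily
-- in that order.  When r is coloured it avoids, for every lower neighbour v, one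
-- colour that is odd on N(v) ∖ r, and the colour of every lower vertex u sharing a
-- higher neighbour v with r.  Then every vertex v with a neighbour is fine: let r be
-- its highest neighbour.  If deg v is odd, some colour is odd on N(v).  Otherwise
-- N(v) ∖ r has odd size and is coloured before r; its odd colour was forbidden at r
-- (directly if v < r, as the colour of some u ∈ N(v) ∖ r if v > r), so it stays odd
-- on N(v).  Since the lower neighbours of a vertex of H form a clique of size ≤ t, the
-- two forbidden families have at most 3ℓt + ℓ + z and 5ℓt + 2ℓ + z members (z < ℓ),
-- so 8ℓt + 5ℓ − 1 colours suffice.

open import Defs
open import Data.Bool using (Bool; true; false; _∧_; not; if_then_else_; T)
open import Data.Bool.Properties using (∧-zeroʳ; ∧-identityʳ; ∧-comm; T-≡)
open import Data.Fin using (Fin; zero; suc; toℕ; punchIn; punchOut)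
open import Data.Fin.Properties using (toℕ-injective; toℕ<n; punchIn-punchOut; pigeonhole)
  renaming (_≟_ to _≟ᶠ_)
open import Data.List
  using (List; []; _∷_; [_]; length; map; filter; filterᵇ; allFin; tabulate; upTo; _++_; lookup; cartesianProduct)
open import Data.List.Properties
  using (length-map; length-tabulate; length-++; length-upTo; filter-notAll; filter-≐; map-cong-local)
open import Data.List.Membership.Propositional using (_∈_; _∉_; find)
open import Data.List.Membership.Propositional.Properties
  using ( ∈-++⁺ˡ; ∈-++⁺ʳ; ∈-cartesianProduct⁺; ∈-map⁺; ∈-map⁻; ∈-filter⁺; ∈-filter⁻; ∈-allFin
        ; ∈-upTo⁺; ∈-upTo⁻; ∈-lookup; ∈-deduplicate⁻)
open import Data.List.Membership.Setoid.Properties using (index-injective)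
open import Data.List.Relation.Binary.Subset.Propositional using (_⊆_)
open import Data.List.Relation.Unary.All as All using (All; []; _∷_; all?)
open import Data.List.Relation.Unary.All.Properties using (¬Any⇒All¬; ¬All⇒Any¬)
open import Data.List.Relation.Unary.Any using (here; there; any?; index)
open import Data.Nat.Properties
open import Algebra.Properties.CommutativeSemigroup +-commutativeSemigroup
  using (x∙yz≈y∙xz)
open import Data.List.Relation.Unary.AllPairs using (_∷_)
open import Data.List.Extrema.Nat using (argmax; argmax-all; f[⊥]≤f[argmax]; f[xs]≤f[argmax])
open import Data.List.Relation.Unary.Unique.Propositional using (Unique)
open import Data.List.Relation.Unary.Unique.Propositional.Properties
  using (applyUpTo⁺₁; map⁺; filter⁺; allFin⁺)
open import Data.List.Relation.Unary.Unique.DecPropositional.Properties _≟_ using (deduplicate-!)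
open import Data.List.Membership.DecPropositional _≟_ using (_∈?_)
import Data.List.Membership.DecPropositional as DecMembership
open import Data.Nat using (ℕ; zero; suc; _+_; _*_; _∸_; _≤_; _<_; _%_; _≡ᵇ_; ∣_-_∣; z≤n; s≤s)
open import Data.Nat.DivMod using (%-distribˡ-+; m%n<n)
open import Data.Nat.Induction using (<-wellFounded)
open import Data.Nat.Tactic.RingSolver using (solve-∀)
open import Data.Product using (_×_; _,_; Σ; ∃; proj₁; proj₂)
open import Data.Product.Properties using (≡-dec)
open import Data.Sum using (_⊎_; inj₁; inj₂)
open import Data.Vec.Functional using (insertAt)
open import Data.Vec.Functional.Properties using (insertAt-lookup; insertAt-punchIn)
open import Function using (_∘_; id; Equivalence)
open import Induction.WellFounded using (Acc; acc)
open import Relation.Binary.PropositionalEquality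
  using (_≡_; _≢_; refl; cong; cong₂; subst; subst₂; trans; module ≡-Reasoning)
  renaming (sym to ≡-sym; setoid to ≡-setoid)
open import Relation.Binary using (tri<; tri≈; tri>; DecidableEquality)
open import Relation.Nullary using (yes; no; does; contradiction)
open import Relation.Unary using (Decidable)
open import Relation.Nullary.Decidable using (¬?; T?; dec-true; dec-false)

multiplicity : ℕ → List ℕ → ℕ
multiplicity α cs = length (filter (_≟ α) cs)

length-filter-¬ : ∀ {A : Set} {P : A → Set} (P? : Decidable P) xs →
                  length (filter P? xs) + length (filter (¬? ∘ P?) xs) ≡ length xs
length-filter-¬ P? [] = refl
length-filter-¬ P? (x ∷ xs) with does (P? x)
... | true  = cong suc (length-filter-¬ P? xs)
... | false = trans (+-suc _ _) (cong suc (length-filter-¬ P? xs))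

filter-filter-⇒ : ∀ {A : Set} {P Q : A → Set} (P? : Decidable P) (Q? : Decidable Q) →
                  (∀ {x} → P x → Q x) → ∀ xs → filter P? (filter Q? xs) ≡ filter P? xs
filter-filter-⇒ P? Q? P⇒Q [] = refl
filter-filter-⇒ P? Q? P⇒Q (x ∷ xs) with Q? x | P? x in eqP
... | yes _ | yes _ rewrite eqP = cong (x ∷_) (filter-filter-⇒ P? Q? P⇒Q xs)
... | yes _ | no _  rewrite eqP = filter-filter-⇒ P? Q? P⇒Q xs
... | no ¬q | yes p = contradiction (P⇒Q p) ¬q
... | no _  | no _  = filter-filter-⇒ P? Q? P⇒Q xs

even+even : ∀ m n → m % 2 ≡ 0 → n % 2 ≡ 0 → (m + n) % 2 ≡ 0
even+even m n m-even n-even = begin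
  (m + n) % 2           ≡⟨ %-distribˡ-+ m n 2 ⟩
  (m % 2 + n % 2) % 2   ≡⟨ cong₂ (λ a b → (a + b) % 2) m-even n-even ⟩
  0                     ∎
  where open ≡-Reasoning

suc-even : ∀ m → m % 2 ≡ 0 → suc m % 2 ≡ 1
suc-even m m-even = begin
  (1 + m) % 2           ≡⟨ %-distribˡ-+ 1 m 2 ⟩
  (1 + m % 2) % 2       ≡⟨ cong (λ a → (1 + a) % 2) m-even ⟩
  1                     ∎
  where open ≡-Reasoning

not-odd⇒even : ∀ m → m % 2 ≢ 1 → m % 2 ≡ 0
not-odd⇒even m m-not-odd with m % 2 | m%n<n m 2
... | 0 | _ = refl
... | 1 | _ = contradiction refl m-not-odd
... | suc (suc _) | s≤s (s≤s ())

-- Induct on the length: dropping every copy of one colour keeps the other multiplicities.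
even-multiplicities⇒even-length : ∀ cs → All (λ c → multiplicity c cs % 2 ≡ 0) cs →
                                   length cs % 2 ≡ 0
even-multiplicities⇒even-length cs = go cs (<-wellFounded (length cs))
  where
  go : ∀ cs → Acc _<_ (length cs) → All (λ c → multiplicity c cs % 2 ≡ 0) cs →
       length cs % 2 ≡ 0
  go [] _ _ = refl
  go cs@(c ∷ _) (acc rec) all-even@(c-even ∷ _) =
    subst (λ l → l % 2 ≡ 0) (length-filter-¬ (_≟ c) cs)
      (even+even (multiplicity c cs) (length others) c-even (go others (rec shorter) others-even))
    where
    others = filter (¬? ∘ (_≟ c)) cs
    shorter : length others < length cs
    shorter = filter-notAll (¬? ∘ (_≟ c)) cs (here λ c≢c → c≢c refl)
    others-even : All (λ d → multiplicity d others % 2 ≡ 0) others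
    others-even = All.tabulate λ {d} d∈others →
      let d∈cs , d≢c = ∈-filter⁻ (¬? ∘ (_≟ c)) d∈others in
      subst (λ l → length l % 2 ≡ 0)
            (≡-sym (filter-filter-⇒ (_≟ d) (¬? ∘ (_≟ c))
                                    (λ x≡d x≡c → d≢c (trans (≡-sym x≡d) x≡c)) cs))
            (All.lookup all-even d∈cs)

oddColour : List ℕ → ℕ
oddColour cs with any? (λ c → multiplicity c cs % 2 ≟ 1) cs
... | yes odd-one = proj₁ (find odd-one)
... | no _        = 0

oddColour-odd : ∀ cs → length cs % 2 ≡ 1 →
                oddColour cs ∈ cs × multiplicity (oddColour cs) cs % 2 ≡ 1
oddColour-odd cs cs-odd with any? (λ c → multiplicity c cs % 2 ≟ 1) cs
... | yes odd-one = proj₂ (find odd-one)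
... | no none-odd = contradiction
  (trans (≡-sym cs-odd)
         (even-multiplicities⇒even-length cs
           (All.map (λ {c} → not-odd⇒even (multiplicity c cs)) (¬Any⇒All¬ cs none-odd))))
  λ ()

lookup-injective : ∀ {A : Set} {xs : List A} → Unique xs →
                   ∀ i j → lookup xs i ≡ lookup xs j → i ≡ j
lookup-injective (_ ∷ _)   zero    zero    _  = refl
lookup-injective (x∉ ∷ _)  zero    (suc j) eq = contradiction eq (All.lookup x∉ (∈-lookup j))
lookup-injective (x∉ ∷ _)  (suc i) zero    eq = contradiction (≡-sym eq) (All.lookup x∉ (∈-lookup i))
lookup-injective (_ ∷ xs!) (suc i) (suc j) eq = cong suc (lookup-injective xs! i j eq)

Unique-⊆⇒length≤ : ∀ {A : Set} {xs ys : List A} → Unique xs → xs ⊆ ys → length xs ≤ length ys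
Unique-⊆⇒length≤ {xs = xs} xs! xs⊆ys = ≮⇒≥ λ ys<xs →
  let i , j , i<j , same-index = pigeonhole ys<xs (λ i → index (xs⊆ys (∈-lookup i)))
  in <⇒≢ i<j (cong toℕ (lookup-injective xs! i j (index-injective (≡-setoid _) _ _ same-index)))

upTo-unique : ∀ N → Unique (upTo N)
upTo-unique N = applyUpTo⁺₁ id N (λ i<j _ → <⇒≢ i<j)

∉-upTo : ∀ N (L : List ℕ) → length L < N → ∃ λ c → c < N × c ∉ L
∉-upTo N L L<N with all? (_∈? L) (upTo N)
... | yes upTo⊆L = contradiction
  (Unique-⊆⇒length≤ (upTo-unique N) (All.lookup upTo⊆L))
  (<⇒≱ (subst (length L <_) (≡-sym (length-upTo N)) L<N))
... | no upTo⊈L =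
  let c , c∈upTo , c∉L = find (¬All⇒Any¬ (_∈? L) (upTo N) upTo⊈L)
  in c , ∈-upTo⁻ c∈upTo , c∉L

coloursUsed-≤ : ∀ G (φ : Fin (n G) → ℕ) N → (∀ w → φ w < N) → coloursUsed G φ ≤ N
coloursUsed-≤ G φ N φ<N =
  subst (coloursUsed G φ ≤_) (length-upTo N)
    (Unique-⊆⇒length≤ (deduplicate-! _) λ c∈ → ∈-upTo⁺ (bounded (∈-deduplicate⁻ _≟_ _ c∈)))
  where
  bounded : ∀ {c} → c ∈ map φ (allFin (n G)) → c < N
  bounded c∈ with w , _ , refl ← ∈-map⁻ φ c∈ = φ<N w

count-tabulate : ∀ {A : Set} {n} (p : A → Bool) (f : Fin n → A) →
                 length (filterᵇ p (tabulate f)) ≡ count (p ∘ f)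
count-tabulate {n = zero}  p f = refl
count-tabulate {n = suc n} p f with p (f zero)
... | true  = cong suc (trans (count-tabulate p (f ∘ suc)) (≡-sym (count-tabulate (p ∘ f) suc)))
... | false = trans (count-tabulate p (f ∘ suc)) (≡-sym (count-tabulate (p ∘ f) suc))

indicator : Bool → ℕ
indicator b = if b then 1 else 0

count-suc : ∀ {n} (p : Fin (suc n) → Bool) → count p ≡ indicator (p zero) + count (p ∘ suc)
count-suc p with p zero
... | true  = cong suc (count-tabulate p suc)
... | false = count-tabulate p suc

count-cong : ∀ {n} {p q : Fin n → Bool} → (∀ w → p w ≡ q w) → count p ≡ count q
count-cong {n} {p} {q} p≗q = cong length
  (filter-≐ (T? ∘ p) (T? ∘ q) ((λ {w} → subst T (p≗q w)) , (λ {w} → subst T (≡-sym (p≗q w))))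
            (allFin n))

_∖_ : ∀ {n} → (Fin n → Bool) → Fin n → Fin n → Bool
(p ∖ r) w = p w ∧ not (does (w ≟ᶠ r))

count-∖ : ∀ {n} (p : Fin n → Bool) r → count p ≡ indicator (p r) + count (p ∖ r)
count-∖ p zero = begin
  count p
    ≡⟨ count-suc p ⟩
  indicator (p zero) + count (p ∘ suc)
    ≡⟨ cong (indicator (p zero) +_) (count-cong (λ w → ≡-sym (∧-identityʳ (p (suc w))))) ⟩
  indicator (p zero) + count ((p ∖ zero) ∘ suc)
    ≡⟨ cong (λ b → indicator (p zero) + (indicator b + count ((p ∖ zero) ∘ suc)))
            (∧-zeroʳ (p zero)) ⟨
  indicator (p zero) + (indicator (p zero ∧ false) + count ((p ∖ zero) ∘ suc))
    ≡⟨ cong (indicator (p zero) +_) (count-suc (p ∖ zero)) ⟨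
  indicator (p zero) + count (p ∖ zero)
    ∎
  where open ≡-Reasoning
count-∖ p (suc r) = begin
  count p
    ≡⟨ count-suc p ⟩
  indicator (p zero) + count (p ∘ suc)
    ≡⟨ cong (indicator (p zero) +_) (count-∖ (p ∘ suc) r) ⟩
  indicator (p zero) + (indicator (p (suc r)) + count ((p ∘ suc) ∖ r))
    ≡⟨ x∙yz≈y∙xz (indicator (p zero)) (indicator (p (suc r))) _ ⟩
  indicator (p (suc r)) + (indicator (p zero) + count ((p ∖ suc r) ∘ suc))
    ≡⟨ cong (λ b → indicator (p (suc r)) + (indicator b + count ((p ∖ suc r) ∘ suc)))
            (∧-identityʳ (p zero)) ⟨
  indicator (p (suc r)) + (indicator (p zero ∧ true) + count ((p ∖ suc r) ∘ suc))
    ≡⟨ cong (indicator (p (suc r)) +_) (count-suc (p ∖ suc r)) ⟨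
  indicator (p (suc r)) + count (p ∖ suc r)
    ∎
  where open ≡-Reasoning

count-∖-true : ∀ {n} (p : Fin n → Bool) {r} → p r ≡ true → count p ≡ suc (count (p ∖ r))
count-∖-true p {r} pr = trans (count-∖ p r) (cong (λ b → indicator b + count (p ∖ r)) pr)

count-∖-false : ∀ {n} (p : Fin n → Bool) {r} → p r ≡ false → count p ≡ count (p ∖ r)
count-∖-false p {r} pr = trans (count-∖ p r) (cong (λ b → indicator b + count (p ∖ r)) pr)

∈-filterᵇ-allFin⁻ : ∀ {n} (p : Fin n → Bool) {w} → w ∈ filterᵇ p (allFin n) → p w ≡ true
∈-filterᵇ-allFin⁻ {n} p w∈ = Equivalence.to T-≡ (proj₂ (∈-filter⁻ (T? ∘ p) {xs = allFin n} w∈))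

∈-filterᵇ-allFin⁺ : ∀ {n} (p : Fin n → Bool) {w} → p w ≡ true → w ∈ filterᵇ p (allFin n)
∈-filterᵇ-allFin⁺ p {w} pw = ∈-filter⁺ (T? ∘ p) (∈-allFin w) (Equivalence.from T-≡ pw)

multiplicity-map-filterᵇ : ∀ {A : Set} (p : A → Bool) (φ : A → ℕ) α xs →
  length (filterᵇ (λ w → p w ∧ (φ w ≡ᵇ α)) xs) ≡ multiplicity α (map φ (filterᵇ p xs))
multiplicity-map-filterᵇ p φ α [] = refl
multiplicity-map-filterᵇ p φ α (x ∷ xs) with p x
... | false = multiplicity-map-filterᵇ p φ α xs
... | true with φ x ≡ᵇ α
...   | true  = cong suc (multiplicity-map-filterᵇ p φ α xs)
...   | false = multiplicity-map-filterᵇ p φ α xs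

∖-true : ∀ {n} (p : Fin n → Bool) {r w} → (p ∖ r) w ≡ true → p w ≡ true × w ≢ r
∖-true p {r} {w} e with p w | w ≟ᶠ r
... | true  | no w≢r = refl , w≢r
... | true  | yes _  = contradiction e λ ()
... | false | _      = contradiction e λ ()

xy∧z≡xz∧y : ∀ a b c → (a ∧ b) ∧ c ≡ (a ∧ c) ∧ b
xy∧z≡xz∧y true  b c = ∧-comm b c
xy∧z≡xz∧y false b c = refl

maximum-by : ∀ {A : Set} (f : A → ℕ) (xs : List A) → length xs ≢ 0 →
             ∃ λ m → m ∈ xs × (∀ {x} → x ∈ xs → f x ≤ f m)
maximum-by f []       nonempty = contradiction refl nonempty
maximum-by f (x ∷ xs) _ = argmax f x xs , argmax-all f (here refl) (All.tabulate there) , bound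
  where
  bound : ∀ {y} → y ∈ x ∷ xs → f y ≤ f (argmax f x xs)
  bound (here refl) = f[⊥]≤f[argmax] {f = f} x xs
  bound (there y∈)  = All.lookup (f[xs]≤f[argmax] {f = f} x xs) y∈

-- Greedy odd colouring along a ranking

adj⇒≢ : ∀ (G : Graph) {x y} → adj G x y ≡ true → x ≢ y
adj⇒≢ G {x} xy refl = contradiction (trans (≡-sym (irrefl G x)) xy) λ ()

record GreedyOrder (G : Graph) (N : ℕ) : Set where
  field
    rank               : Fin (n G) → ℕ
    rank-injective     : ∀ {u w} → rank u ≡ rank w → u ≡ w
    rankBound          : ℕ
    rank<rankBound     : ∀ w → rank w < rankBound
    lowerNbrs lowerVia : Fin (n G) → List (Fin (n G))
    lowerNbrs-complete : ∀ {v r} → adj G v r ≡ true → rank v < rank r → v ∈ lowerNbrs r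
    lowerVia-complete  : ∀ {v r u} → adj G v r ≡ true → rank r < rank v →
                         adj G v u ≡ true → rank u < rank r → u ∈ lowerVia r
    budget             : ∀ r → length (lowerNbrs r) + length (lowerVia r) < N

module GreedyColouring {G : Graph} {N : ℕ} (O : GreedyOrder G N) where
  open GreedyOrder O

  V : Set
  V = Fin (n G)

  colours : (V → ℕ) → (V → Bool) → List ℕ
  colours ψ p = map ψ (filterᵇ p (allFin (n G)))

  count-colour : ∀ ψ p α → count (λ w → p w ∧ (ψ w ≡ᵇ α)) ≡ multiplicity α (colours ψ p)
  count-colour ψ p α = multiplicity-map-filterᵇ p ψ α (allFin (n G))

  length-colours : ∀ ψ p → length (colours ψ p) ≡ count p
  length-colours ψ p = length-map ψ (filterᵇ p (allFin (n G)))

  forbidden : (V → ℕ) → V → List ℕ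
  forbidden ψ r = map (λ v → oddColour (colours ψ (adj G v ∖ r))) (lowerNbrs r) ++ map ψ (lowerVia r)

  length-forbidden : ∀ ψ r → length (forbidden ψ r) < N
  length-forbidden ψ r = subst (_< N) (≡-sym length-split) (budget r)
    where
    oddAt = λ v → oddColour (colours ψ (adj G v ∖ r))
    length-split : length (forbidden ψ r) ≡ length (lowerNbrs r) + length (lowerVia r)
    length-split = trans (length-++ (map oddAt (lowerNbrs r)))
                         (cong₂ _+_ (length-map oddAt (lowerNbrs r)) (length-map ψ (lowerVia r)))

  choice : ∀ r ψ → ∃ λ c → c < N × c ∉ forbidden ψ r
  choice r ψ = ∉-upTo N (forbidden ψ r) (length-forbidden ψ r)

  -- colourBelow k has coloured the vertices of rank below k; the others still carry 0.
  colourBelow : ℕ → V → ℕ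
  colourBelow zero    w = 0
  colourBelow (suc k) w = if rank w ≡ᵇ k then proj₁ (choice w (colourBelow k)) else colourBelow k w

  colouring : V → ℕ
  colouring = colourBelow rankBound

  colourBelow-step : ∀ k w → rank w ≢ k → colourBelow (suc k) w ≡ colourBelow k w
  colourBelow-step k w w≢k rewrite dec-false (rank w ≟ k) w≢k = refl

  colourBelow-stable : ∀ d k w → rank w < k → colourBelow (d + k) w ≡ colourBelow k w
  colourBelow-stable zero    k w w<k = refl
  colourBelow-stable (suc d) k w w<k =
    trans (colourBelow-step (d + k) w (<⇒≢ (<-≤-trans w<k (m≤n+m k d))))
          (colourBelow-stable d k w w<k)

  colouring-frozen : ∀ k w → k ≤ rankBound → rank w < k → colouring w ≡ colourBelow k w
  colouring-frozen k w k≤bound w<k =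
    trans (cong (λ m → colourBelow m w) (≡-sym (m∸n+n≡m k≤bound)))
          (colourBelow-stable (rankBound ∸ k) k w w<k)

  colouring-chosen : ∀ w → colouring w ≡ proj₁ (choice w (colourBelow (rank w)))
  colouring-chosen w = trans (colouring-frozen (suc (rank w)) w (rank<rankBound w) ≤-refl) chosen
    where
    chosen : colourBelow (suc (rank w)) w ≡ proj₁ (choice w (colourBelow (rank w)))
    chosen rewrite dec-true (rank w ≟ rank w) refl = refl

  colouring-< : ∀ w → colouring w < N
  colouring-< w rewrite colouring-chosen w = proj₁ (proj₂ (choice w (colourBelow (rank w))))

  colouring-∉ : ∀ r → colouring r ∉ forbidden (colourBelow (rank r)) r
  colouring-∉ r rewrite colouring-chosen r = proj₂ (proj₂ (choice r (colourBelow (rank r))))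

  oddColour-count : ∀ ψ p → count p % 2 ≡ 1 →
                    count (λ w → p w ∧ (ψ w ≡ᵇ oddColour (colours ψ p))) % 2 ≡ 1
  oddColour-count ψ p p-odd =
    subst (λ m → m % 2 ≡ 1) (≡-sym (count-colour ψ p (oddColour (colours ψ p))))
      (proj₂ (oddColour-odd (colours ψ p) (subst (λ m → m % 2 ≡ 1) (≡-sym (length-colours ψ p)) p-odd)))

  TopNbr : V → V → Set
  TopNbr v r = adj G v r ≡ true × (∀ {w} → adj G v w ≡ true → rank w ≤ rank r)

  topNbr : ∀ v → count (adj G v) ≢ 0 → ∃ (TopNbr v)
  topNbr v deg≢0 with r , r∈ , r-max ← maximum-by rank (filterᵇ (adj G v) (allFin (n G))) deg≢0 =
    r , ∈-filterᵇ-allFin⁻ (adj G v) r∈ , r-max ∘ ∈-filterᵇ-allFin⁺ (adj G v)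

  module _ {v r : V} (top : TopNbr v r) where

    rest : V → Bool
    rest = adj G v ∖ r

    rest-below : ∀ {w} → rest w ≡ true → rank w < rank r
    rest-below e = let vw , w≢r = ∖-true (adj G v) e in
      ≤∧≢⇒< (proj₂ top vw) (w≢r ∘ rank-injective)

    rest-frozen : colours (colourBelow (rank r)) rest ≡ colours colouring rest
    rest-frozen = map-cong-local (All.tabulate λ {w} w∈ →
      ≡-sym (colouring-frozen (rank r) w (<⇒≤ (rank<rankBound r))
                              (rest-below (∈-filterᵇ-allFin⁻ rest w∈))))

    colour-lowerVia : rank r < rank v → ∀ {α} → α ∈ colours colouring rest →
                      α ∈ map (colourBelow (rank r)) (lowerVia r)
    colour-lowerVia r<v α∈ with u , u∈ , refl ← ∈-map⁻ colouring α∈ =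
      let u-rest = ∈-filterᵇ-allFin⁻ rest u∈
          u<r = rest-below u-rest
      in subst (_∈ _) (≡-sym (colouring-frozen (rank r) u (<⇒≤ (rank<rankBound r)) u<r))
           (∈-map⁺ (colourBelow (rank r))
                   (lowerVia-complete (proj₁ top) r<v (proj₁ (∖-true (adj G v) u-rest)) u<r))

    oddRest-forbidden : count rest % 2 ≡ 1 →
                        oddColour (colours colouring rest) ∈ forbidden (colourBelow (rank r)) r
    oddRest-forbidden rest-odd with <-cmp (rank v) (rank r)
    ... | tri< v<r _ _ = ∈-++⁺ˡ (subst (_∈ _) (cong oddColour rest-frozen)
          (∈-map⁺ (λ v → oddColour (colours (colourBelow (rank r)) (adj G v ∖ r)))
                  (lowerNbrs-complete (proj₁ top) v<r)))
    ... | tri≈ _ v≡r _ = contradiction (rank-injective v≡r) (adj⇒≢ G (proj₁ top))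
    ... | tri> _ _ r<v = ∈-++⁺ʳ _ (colour-lowerVia r<v (proj₁ (oddColour-odd (colours colouring rest)
          (subst (λ m → m % 2 ≡ 1) (≡-sym (length-colours colouring rest)) rest-odd))))

    odd-via-rest : count rest % 2 ≡ 1 →
      count (λ w → adj G v w ∧ (colouring w ≡ᵇ oddColour (colours colouring rest))) % 2 ≡ 1
    odd-via-rest rest-odd =
      subst (λ m → m % 2 ≡ 1) (≡-sym through-rest) (oddColour-count colouring rest rest-odd)
      where
      open ≡-Reasoning
      α = oddColour (colours colouring rest)
      r≢α : colouring r ≢ α
      r≢α r≡α = colouring-∉ r (subst (_∈ forbidden (colourBelow (rank r)) r) (≡-sym r≡α)
                                     (oddRest-forbidden rest-odd))
      r-not-α : (adj G v r ∧ (colouring r ≡ᵇ α)) ≡ false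
      r-not-α = trans (cong (adj G v r ∧_) (dec-false (colouring r ≟ α) r≢α)) (∧-zeroʳ (adj G v r))
      through-rest : count (λ w → adj G v w ∧ (colouring w ≡ᵇ α))
                   ≡ count (λ w → rest w ∧ (colouring w ≡ᵇ α))
      through-rest = begin
        count (λ w → adj G v w ∧ (colouring w ≡ᵇ α))
          ≡⟨ count-∖-false (λ w → adj G v w ∧ (colouring w ≡ᵇ α)) r-not-α ⟩
        count ((λ w → adj G v w ∧ (colouring w ≡ᵇ α)) ∖ r)
          ≡⟨ count-cong (λ w → xy∧z≡xz∧y (adj G v w) (colouring w ≡ᵇ α) (not (does (w ≟ᶠ r)))) ⟩
        count (λ w → rest w ∧ (colouring w ≡ᵇ α))
          ∎

    degree-odd : count rest % 2 ≢ 1 → count (adj G v) % 2 ≡ 1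
    degree-odd rest-not-odd = subst (λ m → m % 2 ≡ 1) (≡-sym (count-∖-true (adj G v) (proj₁ top)))
                                (suc-even (count rest) (not-odd⇒even (count rest) rest-not-odd))

  colouring-odd : IsOddColouring G colouring
  colouring-odd v deg≢0 with topNbr v deg≢0
  ... | r , top with count (rest top) % 2 ≟ 1
  ...   | yes rest-odd = oddColour (colours colouring (rest top)) , odd-via-rest top rest-odd
  ...   | no  rest-not-odd = oddColour (colours colouring (adj G v)) ,
                             oddColour-count colouring (adj G v) (degree-odd top rest-not-odd)

greedyOddColouring : ∀ {G N} → GreedyOrder G N →
                     Σ (Fin (n G) → ℕ) λ φ → IsOddColouring G φ × (∀ w → φ w < N)
greedyOddColouring O = colouring , colouring-odd , colouring-<
  where open GreedyColouring O

-- Elimination orders of t-trees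

record EliminationOrder (t : ℕ) {m : ℕ} (A : Fin m → Fin m → Bool) : Set where
  field
    rank               : Fin m → ℕ
    rank<              : ∀ x → rank x < m
    rank-injective     : ∀ {x y} → rank x ≡ rank y → x ≡ y
    lowerNbrs          : Fin m → List (Fin m)
    length-lowerNbrs   : ∀ x → length (lowerNbrs x) ≤ t
    lowerNbrs-complete : ∀ {x y} → A x y ≡ true → rank y < rank x → y ∈ lowerNbrs x
    lowerNbrs-clique   : ∀ {x y z} → A x y ≡ true → A x z ≡ true →
                         rank y < rank x → rank z < rank x → y ≢ z → A y z ≡ true

clique-order : ∀ {t} {A : Fin (suc t) → Fin (suc t) → Bool} →
               (∀ i j → i ≢ j → A i j ≡ true) → EliminationOrder t A
clique-order {t} complete = record
  { rank               = toℕ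
  ; rank<              = toℕ<n
  ; rank-injective     = toℕ-injective
  ; lowerNbrs          = others
  ; length-lowerNbrs   = λ x → ≤-reflexive (trans (length-map (punchIn x) (allFin t)) (length-tabulate id))
  ; lowerNbrs-complete = λ _ y<x → ∈-others (λ x≡y → <-irrefl (cong toℕ (≡-sym x≡y)) y<x)
  ; lowerNbrs-clique   = λ _ _ _ _ → complete _ _
  }
  where
  others : Fin (suc t) → List (Fin (suc t))
  others x = map (punchIn x) (allFin t)
  ∈-others : ∀ {x y} → x ≢ y → y ∈ others x
  ∈-others {x} x≢y =
    subst (_∈ others x) (punchIn-punchOut x≢y) (∈-map⁺ (punchIn x) (∈-allFin (punchOut x≢y)))

data Punched {m : ℕ} (v : Fin (suc m)) : Fin (suc m) → Set where
  at      : Punched v v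
  punched : ∀ i → Punched v (punchIn v i)

punched? : ∀ {m} (v w : Fin (suc m)) → Punched v w
punched? v w with v ≟ᶠ w
... | yes refl = at
... | no v≢w   = subst (Punched v) (punchIn-punchOut v≢w) (punched (punchOut v≢w))

-- The eliminated vertex v gets the top rank, so its lower neighbours are all its neighbours.
extend-order : ∀ {t m} {A : Fin (suc m) → Fin (suc m) → Bool} (v : Fin (suc m)) → degree A v ≡ t →
               (∀ i j → A v i ≡ true → A v j ≡ true → i ≢ j → A i j ≡ true) →
               EliminationOrder t (λ i j → A (punchIn v i) (punchIn v j)) → EliminationOrder t A
extend-order {t} {m} {A} v degree-v clique-v O = record
  { rank = rank ; rank< = rank< ; rank-injective = rank-injective
  ; lowerNbrs = lowerNbrs ; length-lowerNbrs = length-lowerNbrs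
  ; lowerNbrs-complete = lowerNbrs-complete ; lowerNbrs-clique = lowerNbrs-clique
  }
  where
  module O = EliminationOrder O

  rank : Fin (suc m) → ℕ
  rank = insertAt O.rank v m

  lowerNbrs : Fin (suc m) → List (Fin (suc m))
  lowerNbrs = insertAt (map (punchIn v) ∘ O.lowerNbrs) v (filterᵇ (A v) (allFin (suc m)))

  rank-v : rank v ≡ m
  rank-v = insertAt-lookup O.rank v m

  rank-punchIn : ∀ i → rank (punchIn v i) ≡ O.rank i
  rank-punchIn = insertAt-punchIn O.rank v m

  lowerNbrs-v : lowerNbrs v ≡ filterᵇ (A v) (allFin (suc m))
  lowerNbrs-v = insertAt-lookup _ v _

  lowerNbrs-punchIn : ∀ i → lowerNbrs (punchIn v i) ≡ map (punchIn v) (O.lowerNbrs i)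
  lowerNbrs-punchIn = insertAt-punchIn _ v _

  rank< : ∀ x → rank x < suc m
  rank< x with punched? v x
  ... | at        rewrite rank-v = ≤-refl
  ... | punched i rewrite rank-punchIn i = m<n⇒m<1+n (O.rank< i)

  rank-injective : ∀ {x y} → rank x ≡ rank y → x ≡ y
  rank-injective {x} {y} e with punched? v x | punched? v y
  ... | at        | at        = refl
  ... | at        | punched j =
    contradiction (trans (≡-sym rank-v) (trans e (rank-punchIn j))) (>⇒≢ (O.rank< j))
  ... | punched i | at        =
    contradiction (trans (≡-sym (rank-punchIn i)) (trans e rank-v)) (<⇒≢ (O.rank< i))
  ... | punched i | punched j =
    cong (punchIn v) (O.rank-injective (trans (≡-sym (rank-punchIn i)) (trans e (rank-punchIn j))))

  length-lowerNbrs : ∀ x → length (lowerNbrs x) ≤ t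
  length-lowerNbrs x with punched? v x
  ... | at        rewrite lowerNbrs-v = ≤-reflexive degree-v
  ... | punched i rewrite lowerNbrs-punchIn i | length-map (punchIn v) (O.lowerNbrs i) = O.length-lowerNbrs i

  lowerNbrs-complete : ∀ {x y} → A x y ≡ true → rank y < rank x → y ∈ lowerNbrs x
  lowerNbrs-complete {x} {y} xy y<x with punched? v x | punched? v y
  ... | at        | _         rewrite lowerNbrs-v = ∈-filterᵇ-allFin⁺ (A v) xy
  ... | punched i | at        =
    contradiction (subst₂ _<_ rank-v (rank-punchIn i) y<x) (<-asym (O.rank< i))
  ... | punched i | punched j rewrite lowerNbrs-punchIn i =
    ∈-map⁺ (punchIn v) (O.lowerNbrs-complete xy (subst₂ _<_ (rank-punchIn j) (rank-punchIn i) y<x))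

  lowerNbrs-clique : ∀ {x y z} → A x y ≡ true → A x z ≡ true →
                     rank y < rank x → rank z < rank x → y ≢ z → A y z ≡ true
  lowerNbrs-clique {x} {y} {z} xy xz y<x z<x y≢z with punched? v x
  ... | at = clique-v y z xy xz y≢z
  ... | punched k with punched? v y | punched? v z
  ...   | at        | _         = contradiction (subst₂ _<_ rank-v (rank-punchIn k) y<x) (<-asym (O.rank< k))
  ...   | punched _ | at        = contradiction (subst₂ _<_ rank-v (rank-punchIn k) z<x) (<-asym (O.rank< k))
  ...   | punched i | punched j =
    O.lowerNbrs-clique xy xz (subst₂ _<_ (rank-punchIn i) (rank-punchIn k) y<x)
                             (subst₂ _<_ (rank-punchIn j) (rank-punchIn k) z<x) (y≢z ∘ cong (punchIn v))

ttree-order : ∀ {t m} {A : Fin m → Fin m → Bool} → IsTTree t m A → EliminationOrder t A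
ttree-order (clique complete)             = clique-order complete
ttree-order (step v degree-v clique-v T) = extend-order v degree-v clique-v (ttree-order T)

lex-bound : ∀ {p q a} m → p < q → a < m → p * m + a < q * m
lex-bound {p} {q} {a} m p<q a<m = begin-strict
  p * m + a   <⟨ +-monoʳ-< (p * m) a<m ⟩
  p * m + m   ≡⟨ +-comm (p * m) m ⟩
  suc p * m   ≤⟨ *-monoˡ-≤ m p<q ⟩
  q * m       ∎
  where open ≤-Reasoning

lex-< : ∀ {p q a b} m → b < m → p * m + a < q * m + b → p < q ⊎ (p ≡ q × a < b)
lex-< {p} {q} {a} {b} m b<m lt with <-cmp p q
... | tri< p<q _ _ = inj₁ p<q
... | tri≈ _ refl _ = inj₂ (refl , +-cancelˡ-< (p * m) a b lt)
... | tri> _ _ q<p = contradiction lt (<-asym (<-≤-trans (lex-bound m q<p b<m) (m≤m+n (p * m) a)))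

lex-injective : ∀ {p q a b} m → a < m → b < m → p * m + a ≡ q * m + b → p ≡ q × a ≡ b
lex-injective {p} {q} {a} {b} m a<m b<m eq with <-cmp p q
... | tri< p<q _ _ = contradiction eq (<⇒≢ (<-≤-trans (lex-bound m p<q a<m) (m≤m+n (q * m) b)))
... | tri≈ _ refl _ = refl , +-cancelˡ-≡ (p * m) a b eq
... | tri> _ _ q<p = contradiction (≡-sym eq) (<⇒≢ (<-≤-trans (lex-bound m q<p b<m) (m≤m+n (p * m) a)))

-- The values b ∸ d, …, b + d; near 0 truncated subtraction only repeats entries.
window : ℕ → ℕ → List ℕ
window b d = map (λ i → b + i ∸ d) (upTo (suc (d + d)))

length-window : ∀ b d → length (window b d) ≡ suc (d + d)
length-window b d = trans (length-map (λ i → b + i ∸ d) (upTo (suc (d + d)))) (length-upTo (suc (d + d)))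

∈-window : ∀ {a b d} → ∣ a - b ∣ ≤ d → a ∈ window b d
∈-window {a} {b} {d} close = subst (_∈ window b d) shifted (∈-map⁺ (λ i → b + i ∸ d) (∈-upTo⁺ offset<))
  where
  a≤b+d = ≤-trans (m≤n+∣m-n∣ a b) (+-monoʳ-≤ b close)
  b≤a+d = ≤-trans (m≤n+∣n-m∣ b a) (+-monoʳ-≤ a close)
  offset< : a + d ∸ b < suc (d + d)
  offset< = s≤s (begin
    a + d ∸ b         ≤⟨ ∸-monoˡ-≤ b (+-monoˡ-≤ d a≤b+d) ⟩
    b + d + d ∸ b     ≡⟨ cong (_∸ b) (+-assoc b d d) ⟩
    b + (d + d) ∸ b   ≡⟨ m+n∸m≡n b (d + d) ⟩
    d + d             ∎)
    where open ≤-Reasoning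
  shifted : b + (a + d ∸ b) ∸ d ≡ a
  shifted = trans (cong (_∸ d) (m+[n∸m]≡n b≤a+d)) (m+n∸n≡m a d)

below : ℕ → ℕ → List ℕ
below b d = map (λ i → b ∸ suc i) (upTo d)

length-below : ∀ b d → length (below b d) ≡ d
length-below b d = trans (length-map (λ i → b ∸ suc i) (upTo d)) (length-upTo d)

∈-below : ∀ {a b d} → a < b → ∣ a - b ∣ ≤ d → a ∈ below b d
∈-below {a} {d = d} a<b close with e , refl ← m≤n⇒∃[o]m+o≡n a<b =
  subst (_∈ below (suc a + e) d) shifted (∈-map⁺ (λ i → suc a + e ∸ suc i) (∈-upTo⁺ e<d))
  where
  e<d : e < d
  e<d = +-cancelˡ-≤ a (suc e) d (begin
    a + suc e         ≡⟨ +-suc a e ⟩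
    suc a + e         ≤⟨ ≤-trans (m≤n+∣n-m∣ (suc a + e) a) (+-monoʳ-≤ a close) ⟩
    a + d             ∎)
    where open ≤-Reasoning
  shifted : suc a + e ∸ suc e ≡ a
  shifted = trans (cong (_∸ suc e) (≡-sym (+-suc a e))) (m+n∸n≡m a (suc e))

length-cartesianProduct : ∀ {A B : Set} (xs : List A) (ys : List B) →
                          length (cartesianProduct xs ys) ≡ length xs * length ys
length-cartesianProduct []       ys = refl
length-cartesianProduct (x ∷ xs) ys = trans (length-++ (map (x ,_) ys))
  (cong₂ _+_ (length-map (x ,_) ys) (length-cartesianProduct xs ys))

box : ∀ {A B C : Set} → List A → List B → List C → List (A × B × C)
box xs ys zs = cartesianProduct xs (cartesianProduct ys zs)

length-box : ∀ {A B C : Set} (xs : List A) (ys : List B) (zs : List C) →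
             length (box xs ys zs) ≡ length xs * (length ys * length zs)
length-box xs ys zs = trans (length-cartesianProduct xs _) (cong (length xs *_) (length-cartesianProduct ys zs))

∈-box : ∀ {A B C : Set} {x : A} {y : B} {z : C} {xs ys zs} →
        x ∈ xs → y ∈ ys → z ∈ zs → (x , y , z) ∈ box xs ys zs
∈-box x∈ y∈ z∈ = ∈-cartesianProduct⁺ x∈ (∈-cartesianProduct⁺ y∈ z∈)

∣m-1+m∣≤1 : ∀ m → ∣ m - suc m ∣ ≤ 1
∣m-1+m∣≤1 zero    = ≤-refl
∣m-1+m∣≤1 (suc m) = ∣m-1+m∣≤1 m

pathAdj⇒∣-∣≤1 : ∀ {m} {i j : Fin m} → pathAdj i j → ∣ toℕ i - toℕ j ∣ ≤ 1
pathAdj⇒∣-∣≤1 {i = i} {j} (inj₁ j≡1+i) rewrite j≡1+i = ∣m-1+m∣≤1 (toℕ i)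
pathAdj⇒∣-∣≤1 {i = i} {j} (inj₂ i≡1+j)
  rewrite i≡1+j | ∣-∣-comm (suc (toℕ j)) (toℕ j) = ∣m-1+m∣≤1 (toℕ j)

≡⇒∣-∣≤1 : ∀ {a b} → a ≡ b → ∣ a - b ∣ ≤ 1
≡⇒∣-∣≤1 {a} refl rewrite ∣n-n∣≡0 a = z≤n

budget-arithmetic : ∀ t ℓ z → z < ℓ →
  t * (3 * ℓ) + (1 * ℓ + z) + (t * (5 * ℓ) + (2 * ℓ + z)) < 8 * ℓ * t + 5 * ℓ ∸ 1
budget-arithmetic t ℓ z z<ℓ = ∸-monoˡ-≤ 1 (begin
  2 + (t * (3 * ℓ) + (1 * ℓ + z) + (t * (5 * ℓ) + (2 * ℓ + z)))
    ≡⟨ collect t ℓ z ⟩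
  8 * ℓ * t + 3 * ℓ + (suc z + suc z)
    ≤⟨ +-monoʳ-≤ (8 * ℓ * t + 3 * ℓ) (+-mono-≤ z<ℓ z<ℓ) ⟩
  8 * ℓ * t + 3 * ℓ + (ℓ + ℓ)
    ≡⟨ regroup t ℓ ⟩
  8 * ℓ * t + 5 * ℓ
    ∎)
  where
  open ≤-Reasoning
  collect : ∀ t ℓ z → 2 + (t * (3 * ℓ) + (1 * ℓ + z) + (t * (5 * ℓ) + (2 * ℓ + z)))
                      ≡ 8 * ℓ * t + 3 * ℓ + (suc z + suc z)
  collect = solve-∀
  regroup : ∀ t ℓ → 8 * ℓ * t + 3 * ℓ + (ℓ + ℓ) ≡ 8 * ℓ * t + 5 * ℓ
  regroup = solve-∀

-- Ranking a subgraph of H ⊠ P ⊠ K_ℓ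

module ProductOrder (H G : Graph) (t k ℓ : ℕ) (O : EliminationOrder t (adj H))
       (f : Fin (n G) → (Fin (n H) × Fin (suc k)) × Fin ℓ)
       (f-injective : ∀ i j → f i ≡ f j → i ≡ j)
       (f-adj : ∀ i j → adj G i j ≡ true → tripleAdj H (suc k) ℓ (f i) (f j)) where

  module O = EliminationOrder O

  X : Fin (n G) → Fin (n H)
  X g = proj₁ (proj₁ (f g))

  Y Z : Fin (n G) → ℕ
  Y g = toℕ (proj₂ (proj₁ (f g)))
  Z g = toℕ (proj₂ (f g))

  Y<1+k : ∀ g → Y g < suc k
  Y<1+k g = toℕ<n (proj₂ (proj₁ (f g)))

  Z<ℓ : ∀ g → Z g < ℓ
  Z<ℓ g = toℕ<n (proj₂ (f g))

  Point : Set
  Point = Fin (n H) × ℕ × ℕ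

  point : Fin (n G) → Point
  point g = X g , Y g , Z g

  point-injective : ∀ {i j} → point i ≡ point j → i ≡ j
  point-injective {i} {j} eq = f-injective i j
    (cong₂ _,_ (cong₂ _,_ (cong proj₁ eq) (toℕ-injective (cong (proj₁ ∘ proj₂) eq)))
               (toℕ-injective (cong (proj₂ ∘ proj₂) eq)))

  _~_ : Fin (n H) → Fin (n H) → Set
  x ~ y = x ≡ y ⊎ adj H x y ≡ true

  adjH-sym : ∀ {x y} → adj H x y ≡ true → adj H y x ≡ true
  adjH-sym {x} {y} xy = trans (Graph.sym H y x) xy

  strong-coordinates : ∀ {x x' : Fin (n H)} {y y' : Fin (suc k)} →
    strongAdj (λ a b → adj H a b ≡ true) pathAdj (x , y) (x' , y') → x ~ x' × ∣ toℕ y - toℕ y' ∣ ≤ 1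
  strong-coordinates {y = y} (inj₁ (xx , refl)) = inj₂ xx , ≡⇒∣-∣≤1 {toℕ y} refl
  strong-coordinates (inj₂ (inj₁ (refl , yy))) = inj₁ refl , pathAdj⇒∣-∣≤1 yy
  strong-coordinates (inj₂ (inj₂ (xx , yy)))   = inj₂ xx , pathAdj⇒∣-∣≤1 yy

  adjacent-coordinates : ∀ {i j} → adj G i j ≡ true → X i ~ X j × ∣ Y i - Y j ∣ ≤ 1
  adjacent-coordinates {i} {j} ij with f-adj i j ij
  ... | inj₁ (xy , _)         = strong-coordinates xy
  ... | inj₂ (inj₁ (xy≡ , _)) = inj₁ (cong proj₁ xy≡) , ≡⇒∣-∣≤1 (cong (toℕ ∘ proj₂) xy≡)
  ... | inj₂ (inj₂ (xy , _))  = strong-coordinates xy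

  column : Fin (n G) → ℕ
  column g = O.rank (X g) * suc k + Y g

  column< : ∀ g → column g < n H * suc k
  column< g = lex-bound (suc k) (O.rank< (X g)) (Y<1+k g)

  rank : Fin (n G) → ℕ
  rank g = column g * ℓ + Z g

  rank< : ∀ g → rank g < n H * suc k * ℓ
  rank< g = lex-bound ℓ (column< g) (Z<ℓ g)

  rank-injective : ∀ {u w} → rank u ≡ rank w → u ≡ w
  rank-injective {u} {w} eq =
    let column≡ , z≡ = lex-injective ℓ (Z<ℓ u) (Z<ℓ w) eq
        rank≡ , y≡   = lex-injective (suc k) (Y<1+k u) (Y<1+k w) column≡
    in point-injective (cong₂ _,_ (O.rank-injective rank≡) (cong₂ _,_ y≡ z≡))

  rank-<-cases : ∀ {u r} → rank u < rank r →
    O.rank (X u) < O.rank (X r) ⊎ (X u ≡ X r × (Y u < Y r ⊎ (Y u ≡ Y r × Z u < Z r)))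
  rank-<-cases {u} {r} u<r with lex-< ℓ (Z<ℓ r) u<r
  ... | inj₂ (column≡ , z<) =
    let rank≡ , y≡ = lex-injective (suc k) (Y<1+k u) (Y<1+k r) column≡
    in inj₂ (O.rank-injective rank≡ , inj₂ (y≡ , z<))
  ... | inj₁ column< with lex-< (suc k) (Y<1+k r) column<
  ...   | inj₁ rank<         = inj₁ rank<
  ...   | inj₂ (rank≡ , y<) = inj₂ (O.rank-injective rank≡ , inj₁ y<)

  across lowerRows : Fin (n G) → ℕ → List Point
  across    r d = box (O.lowerNbrs (X r)) (window (Y r) d) (upTo ℓ)
  lowerRows r d = box [ X r ] (below (Y r) d) (upTo ℓ)

  lowerInRow : Fin (n G) → List Point
  lowerInRow r = box [ X r ] [ Y r ] (upTo (Z r))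

  region : Fin (n G) → ℕ → List Point
  region r d = across r d ++ (lowerRows r d ++ lowerInRow r)

  ∈-region : ∀ {u r} d → rank u < rank r → (O.rank (X u) < O.rank (X r) → X u ∈ O.lowerNbrs (X r)) →
             ∣ Y u - Y r ∣ ≤ d → point u ∈ region r d
  ∈-region {u} {r} d u<r lower close with rank-<-cases u<r
  ... | inj₁ x< = ∈-++⁺ˡ {ys = lowerRows r d ++ lowerInRow r}
    (∈-box {xs = O.lowerNbrs (X r)} {window (Y r) d} {upTo ℓ}
           (lower x<) (∈-window close) (∈-upTo⁺ (Z<ℓ u)))
  ... | inj₂ (x≡ , inj₁ y<) =
    ∈-++⁺ʳ (across r d) (∈-++⁺ˡ {ys = lowerInRow r}
      (∈-box {xs = [ X r ]} {below (Y r) d} {upTo ℓ} (here x≡) (∈-below y< close) (∈-upTo⁺ (Z<ℓ u))))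
  ... | inj₂ (x≡ , inj₂ (y≡ , z<)) =
    ∈-++⁺ʳ (across r d) (∈-++⁺ʳ (lowerRows r d)
      (∈-box {xs = [ X r ]} {[ Y r ]} {upTo (Z r)} (here x≡) (here y≡) (∈-upTo⁺ z<)))

  length-region : ∀ r d → length (region r d) ≤ t * (suc (d + d) * ℓ) + (d * ℓ + Z r)
  length-region r d = begin
    length (region r d)
      ≡⟨ length-++ (across r d) ⟩
    length (across r d) + length (lowerRows r d ++ lowerInRow r)
      ≡⟨ cong (length (across r d) +_) (length-++ (lowerRows r d)) ⟩
    length (across r d) + (length (lowerRows r d) + length (lowerInRow r))
      ≡⟨ cong₂ _+_ length-across (cong₂ _+_ length-lowerRows length-lowerInRow) ⟩
    length (O.lowerNbrs (X r)) * (suc (d + d) * ℓ) + (d * ℓ + Z r)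
      ≤⟨ +-monoˡ-≤ (d * ℓ + Z r) (*-monoˡ-≤ (suc (d + d) * ℓ) (O.length-lowerNbrs (X r))) ⟩
    t * (suc (d + d) * ℓ) + (d * ℓ + Z r)
      ∎
    where
    open ≤-Reasoning
    length-across : length (across r d) ≡ length (O.lowerNbrs (X r)) * (suc (d + d) * ℓ)
    length-across = trans (length-box (O.lowerNbrs (X r)) (window (Y r) d) (upTo ℓ))
      (cong (length (O.lowerNbrs (X r)) *_) (cong₂ _*_ (length-window (Y r) d) (length-upTo ℓ)))
    length-lowerRows : length (lowerRows r d) ≡ d * ℓ
    length-lowerRows = trans (length-box [ X r ] (below (Y r) d) (upTo ℓ))
      (trans (*-identityˡ (length (below (Y r) d) * length (upTo ℓ)))
             (cong₂ _*_ (length-below (Y r) d) (length-upTo ℓ)))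
    length-lowerInRow : length (lowerInRow r) ≡ Z r
    length-lowerInRow = trans (length-box [ X r ] [ Y r ] (upTo (Z r)))
      (trans (*-identityˡ (1 * length (upTo (Z r))))
             (trans (*-identityˡ (length (upTo (Z r)))) (length-upTo (Z r))))

  _≟ᵖ_ : DecidableEquality Point
  _≟ᵖ_ = ≡-dec _≟ᶠ_ (≡-dec _≟_ _≟_)

  open DecMembership _≟ᵖ_ using () renaming (_∈?_ to _∈ᵖ?_)

  verticesAt : List Point → List (Fin (n G))
  verticesAt ps = filter (λ g → point g ∈ᵖ? ps) (allFin (n G))

  ∈-verticesAt : ∀ {g ps} → point g ∈ ps → g ∈ verticesAt ps
  ∈-verticesAt {g} {ps} = ∈-filter⁺ (λ g → point g ∈ᵖ? ps) (∈-allFin g)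

  length-verticesAt : ∀ ps → length (verticesAt ps) ≤ length ps
  length-verticesAt ps = subst (_≤ length ps) (length-map point (verticesAt ps))
    (Unique-⊆⇒length≤ (map⁺ point-injective (filter⁺ (λ g → point g ∈ᵖ? ps) (allFin⁺ (n G))))
                      points⊆ps)
    where
    points⊆ps : map point (verticesAt ps) ⊆ ps
    points⊆ps p∈ with g , g∈ , refl ← ∈-map⁻ point p∈ =
      proj₂ (∈-filter⁻ (λ g → point g ∈ᵖ? ps) {xs = allFin (n G)} g∈)

  -- The lower neighbours of X v form a clique, which brings X u next to X r.
  lowerNbr-across : ∀ {v r u} → adj G v r ≡ true → rank r < rank v → adj G v u ≡ true →
                    O.rank (X u) < O.rank (X r) → X u ∈ O.lowerNbrs (X r)
  lowerNbr-across {v} {r} {u} vr r<v vu u<r = O.lowerNbrs-complete (adjacent-across vr-X vu-X) u<r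
    where
    vr-X = proj₁ (adjacent-coordinates vr)
    vu-X = proj₁ (adjacent-coordinates vu)
    adjacent-across : X v ~ X r → X v ~ X u → adj H (X r) (X u) ≡ true
    adjacent-across (inj₁ v≡r) (inj₁ v≡u) = contradiction (cong O.rank (trans (≡-sym v≡u) v≡r)) (<⇒≢ u<r)
    adjacent-across (inj₁ v≡r) (inj₂ vu)  = subst (λ x → adj H x (X u) ≡ true) v≡r vu
    adjacent-across (inj₂ vr)  (inj₁ v≡u) = subst (λ x → adj H (X r) x ≡ true) v≡u (adjH-sym vr)
    adjacent-across (inj₂ vr)  (inj₂ vu) with rank-<-cases r<v
    ... | inj₁ r<v = O.lowerNbrs-clique vr vu r<v (<-trans u<r r<v)
                                        (λ r≡u → <⇒≢ u<r (cong O.rank (≡-sym r≡u)))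
    ... | inj₂ (r≡v , _) = contradiction (≡-sym r≡v) (adj⇒≢ H vr)

  lowerNbr-adjacent : ∀ {v r} → adj G v r ≡ true → O.rank (X v) < O.rank (X r) → X v ∈ O.lowerNbrs (X r)
  lowerNbr-adjacent vr v<r with proj₁ (adjacent-coordinates vr)
  ... | inj₁ v≡r = contradiction (cong O.rank v≡r) (<⇒≢ v<r)
  ... | inj₂ vr-H = O.lowerNbrs-complete (adjH-sym vr-H) v<r

  distance-via : ∀ {v r u} → adj G v r ≡ true → adj G v u ≡ true → ∣ Y u - Y r ∣ ≤ 2
  distance-via {v} {r} {u} vr vu = ≤-trans (∣-∣-triangle (Y u) (Y v) (Y r))
    (+-mono-≤ (subst (_≤ 1) (∣-∣-comm (Y v) (Y u)) (proj₂ (adjacent-coordinates vu)))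
              (proj₂ (adjacent-coordinates vr)))

  greedyOrder : GreedyOrder G (8 * ℓ * t + 5 * ℓ ∸ 1)
  greedyOrder = record
    { rank               = rank
    ; rank-injective     = rank-injective
    ; rankBound          = n H * suc k * ℓ
    ; rank<rankBound     = rank<
    ; lowerNbrs          = λ r → verticesAt (region r 1)
    ; lowerVia           = λ r → verticesAt (region r 2)
    ; lowerNbrs-complete = λ vr v<r →
        ∈-verticesAt (∈-region 1 v<r (lowerNbr-adjacent vr) (proj₂ (adjacent-coordinates vr)))
    ; lowerVia-complete  = λ vr r<v vu u<r →
        ∈-verticesAt (∈-region 2 u<r (lowerNbr-across vr r<v vu) (distance-via vr vu))
    ; budget             = λ r → ≤-<-trans
        (+-mono-≤ (≤-trans (length-verticesAt (region r 1)) (length-region r 1))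
                  (≤-trans (length-verticesAt (region r 2)) (length-region r 2)))
        (budget-arithmetic t ℓ (Z r) (Z<ℓ r))
    }

-- The hypothesis 1 ≤ ℓ is unused: the budget only needs Z r < ℓ for the vertex r at hand.
theorem4 : (t ℓ k : ℕ) → 1 ≤ ℓ → (H : Graph) → TTree t H →
           (G : Graph) → IsSubgraphOfTriple G H (suc k) ℓ →
           Σ (Fin (n G) → ℕ) λ φ →
             IsOddColouring G φ × coloursUsed G φ ≤ 8 * ℓ * t + 5 * ℓ ∸ 1
theorem4 t ℓ k _ H H-ttree G (f , f-injective , f-adj) =
  let order = ProductOrder.greedyOrder H G t k ℓ (ttree-order H-ttree) f f-injective f-adj
      φ , φ-odd , φ<bound = greedyOddColouring order
  in φ , φ-odd , coloursUsed-≤ G φ (8 * ℓ * t + 5 * ℓ ∸ 1) φ<bound
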